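{- There is a function $h:\omega^2\rightarrow\omega$ such that the following holds. Let $\chi:[\omega]^2\rightarrow\omega$ be a $2$-bounded coloring, $A\subseteq\omega$ a set normal for $\chi$, $\mathcal{I}$ an ideal on $\omega$ containing all finite sets, $X\subseteq A$ a finite polychromatic set with $|X|\leq p$ and $A\cap E(X)\notin\mathcal{I}$, and $Z\subseteq A\cap E(X)$ with $|Z|\geq h(p,n)$. Then there is $Y\subseteq Z$ with $|Y|\geq n$ such that $X\cup Y$ is polychromatic and $A\cap E(X\cup Y)\notin\mathcal{I}$.
   Context: A coloring $\chi:[\omega]^2\rightarrow\omega$ is $2$-bounded if each color is assigned to at most two pairs; write $\chi(a,b)$ for $\chi(\{a,b\})$. A set is polychromatic for $\chi$ if distinct pairs from it receive distinct colors. A set $A\subseteq\omega$ is normal (for $\chi$) if whenever $a_0<a_1$ and $b_0<b_1$ are in $A$ with $\chi(a_0,a_1)=\chi(b_0,b_1)$, then $a_1=b_1$. For finite polychromatic $X$, $E(X)=\{a\in\omega: X\cup\{a\}\text{ is polychromatic}\}$. -}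

module Defs where

open import Level using (0ℓ)
open import Data.Nat using (ℕ; _<_)
open import Data.Product using (_×_)
open import Data.Sum using (_⊎_)
open import Data.Unit using (⊤)
open import Data.List using (List)
open import Data.List.Membership.Propositional using (_∈_)
open import Relation.Nullary using (¬_)
open import Relation.Binary.PropositionalEquality using (_≡_)

Subset : Set₁
Subset = ℕ → Set

-- A coloring of [ω]^2: χ a b is the color of {a,b}; only values with a < b matter.
Coloring : Set
Coloring = ℕ → ℕ → ℕ

-- 2-bounded: no three distinct pairs share a colour.
TwoBounded : Coloring → Set
TwoBounded χ = ∀ a₀ b₀ a₁ b₁ a₂ b₂ → a₀ < b₀ → a₁ < b₁ → a₂ < b₂ →
  χ a₀ b₀ ≡ χ a₁ b₁ → χ a₁ b₁ ≡ χ a₂ b₂ →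
  (a₀ ≡ a₁ × b₀ ≡ b₁) ⊎ (a₀ ≡ a₂ × b₀ ≡ b₂) ⊎ (a₁ ≡ a₂ × b₁ ≡ b₂)

Polychromatic : Coloring → Subset → Set
Polychromatic χ S = ∀ a₀ a₁ b₀ b₁ → S a₀ → S a₁ → S b₀ → S b₁ →
  a₀ < a₁ → b₀ < b₁ → χ a₀ a₁ ≡ χ b₀ b₁ → a₀ ≡ b₀ × a₁ ≡ b₁

Normal : Coloring → Subset → Set
Normal χ A = ∀ a₀ a₁ b₀ b₁ → A a₀ → A a₁ → A b₀ → A b₁ →
  a₀ < a₁ → b₀ < b₁ → χ a₀ a₁ ≡ χ b₀ b₁ → a₁ ≡ b₁

⟦_⟧ : List ℕ → Subset
⟦ L ⟧ x = x ∈ L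

_∪_ : Subset → Subset → Subset
(S ∪ T) x = S x ⊎ T x

_∩_ : Subset → Subset → Subset
(S ∩ T) x = S x × T x

_⊆_ : Subset → Subset → Set
S ⊆ T = ∀ x → S x → T x

E : Coloring → Subset → Subset
E χ X a = Polychromatic χ (X ∪ (λ x → x ≡ a))

record IsIdealWithFinite (I : Subset → Set) : Set₁ where
  field
    downward : ∀ S T → S ⊆ T → I T → I S
    union    : ∀ S T → I S → I T → I (S ∪ T)
    finite   : ∀ (L : List ℕ) → I ⟦ L ⟧
    proper   : ¬ I (λ _ → ⊤)

module Submission where

-- Call a finite core L ⊆ A "positive" if A ∩ E(L) ∉ I.  The bound is
--   h p 0 = 0,   h p (n+1) = (p+1) + (p+1)² + h (p+1) n,
-- and Y is built greedily from the candidates listed in decreasing order.  A round with a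
-- positive core L, |L| ≤ p, rests on two counting lemmas, both of which reduce (by normality
-- of A) a failure of polychromaticity to two pairs with a common top sharing a colour, and then
-- use 2-boundedness to make a pigeonhole argument work:
--  * extension: among any p+1 candidates c some keeps L ∪ {c} positive; otherwise every large
--    point a ∈ A ∩ E(L) outside all the sets E(L ∪ {c}) gives each c a partner x ∈ L with
--    χ(x,a) = χ(c,a), and c ↦ x is injective, so p+1 ≤ |L| ≤ p;
--  * few spoiled: for y chosen among the p+1 largest candidates, at most (p+1)² smaller
--    candidates z leave E(L ∪ {y}), since each determines a pair {q,v} of L ∪ {y} with
--    χ(z,v) = χ(q,v).
-- The remaining ≥ h (p+1) n candidates feed the next round with core L ∪ {y}.  Finally X ∪ Y is
-- polychromatic because A ∩ E(X ∪ Y) ∉ I is nonempty.  Excluded middle is used to extract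
-- conflicts from non-polychromatic sets and to decide membership in the sets E(S).

open import Defs
open import Level using (0ℓ)
open import Axiom.ExcludedMiddle using (ExcludedMiddle)
open import Axiom.DoubleNegationElimination using (DoubleNegationElimination; em⇒dne)
open import Data.Nat using (ℕ; zero; suc; _+_; _*_; _≤_; _<_; _>_; z≤n; s≤s; _≤?_)
open import Data.Nat.Properties
  using (≤-reflexive; ≤-trans; ≤-<-trans; <-irrefl; <-asym; ≤∧≢⇒<; ≰⇒>; >⇒≢; n≮n;
         m≤m+n; m≤n⇒m⊓n≡m; +-suc; +-comm; +-cancelˡ-≤; +-monoʳ-≤; *-mono-≤;
         ≤-decTotalOrder; ≤-totalOrder; module ≤-Reasoning)
open import Data.Product using (Σ; _×_; _,_; proj₁; proj₂)
open import Data.Sum using (_⊎_; inj₁; inj₂)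
open import Data.Empty using (⊥-elim)
open import Data.List using (List; []; _∷_; _++_; length; filter; map; cartesianProduct; take; drop; upTo)
open import Data.List.Properties using (length-++; length-map; length-take; take++drop≡id)
open import Data.List.Relation.Unary.All using (All; []; _∷_)
import Data.List.Relation.Unary.All as All
import Data.List.Relation.Unary.All.Properties as All
open import Data.List.Relation.Unary.Any using (Any; here; there)
open import Data.List.Relation.Unary.AllPairs using (AllPairs; []; _∷_)
import Data.List.Relation.Unary.AllPairs as AllPairs
import Data.List.Relation.Unary.AllPairs.Properties as AllPairsₚ
open import Data.List.Relation.Unary.Unique.Propositional using (Unique)
import Data.List.Relation.Unary.Unique.Propositional.Properties as Unique
open import Data.List.Membership.Propositional using (_∈_; find; lose)
open import Data.List.Membership.Propositional.Properties
  using (∈-∃++; ∈-filter⁻; ∈-cartesianProduct⁺; ∈-upTo⁺; ∈-++⁺ˡ; ∈-++⁺ʳ)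
open import Data.List.Relation.Binary.Permutation.Propositional using (_↭_; ↭-sym; ↭⇒↭ₛ)
open import Data.List.Relation.Binary.Permutation.Propositional.Properties
  using (↭-length; shift; ∈-resp-↭; All-resp-↭)
open import Data.List.Relation.Binary.Permutation.Setoid.Properties using (Unique-resp-↭)
import Relation.Binary.Properties.DecTotalOrder ≤-decTotalOrder as Converse
open import Data.List.Sort Converse.≥-decTotalOrder using (sort; sort-↭; sort-↗)
open import Data.List.Relation.Unary.Sorted.TotalOrder.Properties using (Sorted⇒AllPairs)
open import Data.List.Extrema ≤-totalOrder using (max; xs≤max)
open import Relation.Nullary using (¬_; yes; no; ¬?)
open import Relation.Unary using (Decidable)
open import Relation.Binary.PropositionalEquality
  using (_≡_; _≢_; refl; sym; trans; cong; subst; setoid; ≢-sym; module ≡-Reasoning)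

AllPairs-++⁻ : ∀ {B : Set} {R : B → B → Set} xs {ys} → AllPairs R (xs ++ ys) →
  AllPairs R xs × AllPairs R ys × All (λ x → All (R x) ys) xs
AllPairs-++⁻ []       Rys        = [] , Rys , []
AllPairs-++⁻ (x ∷ xs) (Rx ∷ Rxs) with AllPairs-++⁻ xs Rxs
... | Rxs′ , Rys , Rxsys = All.++⁻ˡ xs Rx ∷ Rxs′ , Rys , All.++⁻ʳ xs Rx ∷ Rxsys

prefix-of-length : ∀ {B : Set} k (xs : List B) → k ≤ length xs →
  Σ (List B) λ cs → Σ (List B) λ rest → xs ≡ cs ++ rest × length cs ≡ k
prefix-of-length k xs k≤|xs| =
  take k xs , drop k xs , sym (take++drop≡id k xs) , trans (length-take k xs) (m≤n⇒m⊓n≡m k≤|xs|)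

length-filter-split : ∀ {P : ℕ → Set} (P? : Decidable P) xs →
  length (filter P? xs) + length (filter (λ x → ¬? (P? x)) xs) ≡ length xs
length-filter-split P? []       = refl
length-filter-split P? (x ∷ xs) with P? x
... | yes _ = cong suc (length-filter-split P? xs)
... | no  _ = trans (+-suc _ _) (cong suc (length-filter-split P? xs))

length-cartesianProduct : ∀ {B C : Set} (xs : List B) (ys : List C) →
  length (cartesianProduct xs ys) ≡ length xs * length ys
length-cartesianProduct []       ys = refl
length-cartesianProduct (x ∷ xs) ys = begin
  length (map (x ,_) ys ++ cartesianProduct xs ys)       ≡⟨ length-++ (map (x ,_) ys) ⟩
  length (map (x ,_) ys) + length (cartesianProduct xs ys)
    ≡⟨ cong (_+ length (cartesianProduct xs ys)) (length-map (x ,_) ys) ⟩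
  length ys + length (cartesianProduct xs ys)            ≡⟨ cong (length ys +_) (length-cartesianProduct xs ys) ⟩
  length ys + length xs * length ys                      ∎
  where open ≡-Reasoning

pigeonhole : ∀ {B C : Set} (R : B → C → Set) {xs : List B} {ys : List C} → Unique xs →
  (∀ {x} → x ∈ xs → Σ C λ y → y ∈ ys × R x y) →
  (∀ {x x′ y} → R x y → R x′ y → x ≡ x′) →
  length xs ≤ length ys
pigeonhole R {[]}     _                 _     _         = z≤n
pigeonhole R {x ∷ xs} (x∉xs ∷ unique) image injective with image (here refl)
... | y , y∈ys , xRy with ∈-∃++ y∈ys
... | ys₁ , ys₂ , refl = begin
  suc (length xs)           ≤⟨ s≤s (pigeonhole R unique image′ injective) ⟩
  suc (length (ys₁ ++ ys₂)) ≡⟨ ↭-length (shift y ys₁ ys₂) ⟨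
  length (ys₁ ++ y ∷ ys₂)   ∎
  where
  open ≤-Reasoning
  image′ : ∀ {x′} → x′ ∈ xs → Σ _ λ y′ → y′ ∈ ys₁ ++ ys₂ × R x′ y′
  image′ x′∈xs with image (there x′∈xs)
  ... | y′ , y′∈ys , x′Ry′ with ∈-resp-↭ (shift y ys₁ ys₂) y′∈ys
  ...   | here refl  = ⊥-elim (All.lookup x∉xs x′∈xs (injective xRy x′Ry′))
  ...   | there y′∈ = y′ , y′∈ , x′Ry′

sort-decreasing : (xs : List ℕ) → Unique xs → Σ (List ℕ) λ ys → AllPairs _>_ ys × ys ↭ xs
sort-decreasing xs unique = sort xs , AllPairs.zipWith strict (non-increasing , distinct) , sort-↭ xs
  where
  non-increasing : AllPairs (λ x y → y ≤ x) (sort xs)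
  non-increasing = Sorted⇒AllPairs Converse.≥-totalOrder (sort-↗ xs)
  distinct : Unique (sort xs)
  distinct = Unique-resp-↭ (setoid ℕ) (↭⇒↭ₛ (↭-sym (sort-↭ xs))) unique
  strict : ∀ {x y} → y ≤ x × x ≢ y → x > y
  strict (y≤x , x≢y) = ≤∧≢⇒< y≤x (≢-sym x≢y)

module _ {χ : Coloring} where

  polychromatic-mono : ∀ {S T} → S ⊆ T → Polychromatic χ T → Polychromatic χ S
  polychromatic-mono S⊆T poly a₀ a₁ b₀ b₁ s₀ s₁ t₀ t₁ =
    poly a₀ a₁ b₀ b₁ (S⊆T _ s₀) (S⊆T _ s₁) (S⊆T _ t₀) (S⊆T _ t₁)

  E-antitone : ∀ {S T} → S ⊆ T → E χ T ⊆ E χ S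
  E-antitone S⊆T a = polychromatic-mono λ where
    x (inj₁ x∈S) → inj₁ (S⊆T x x∈S)
    x (inj₂ x≡a) → inj₂ x≡a

  E⇒polychromatic : ∀ {S a} → E χ S a → Polychromatic χ S
  E⇒polychromatic = polychromatic-mono (λ x → inj₁)

  E⇒polychromatic-∷ : ∀ {L c} → E χ ⟦ L ⟧ c → Polychromatic χ ⟦ c ∷ L ⟧
  E⇒polychromatic-∷ = polychromatic-mono λ where
    x (here x≡c)  → inj₂ x≡c
    x (there x∈L) → inj₁ x∈L

SameColourBelow : Coloring → (t u w : ℕ) → Set
SameColourBelow χ t u w = u < t × w < t × u ≢ w × χ u t ≡ χ w t

same-colour-sym : ∀ {χ t u w} → SameColourBelow χ t u w → SameColourBelow χ t w u
same-colour-sym (u<t , w<t , u≢w , eq) = w<t , u<t , ≢-sym u≢w , sym eq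

same-colour-unique : ∀ {χ t u u′ w} → TwoBounded χ →
  SameColourBelow χ t u w → SameColourBelow χ t u′ w → u ≡ u′
same-colour-unique {u = u} {u′} {w} two-bounded (u<t , w<t , u≢w , eq) (u′<t , _ , u′≢w , eq′)
  with two-bounded u _ w _ u′ _ u<t w<t u′<t eq (sym eq′)
... | inj₁ (u≡w , _)          = ⊥-elim (u≢w u≡w)
... | inj₂ (inj₁ (u≡u′ , _))  = u≡u′
... | inj₂ (inj₂ (w≡u′ , _))  = ⊥-elim (u′≢w (sym w≡u′))

E-separates : ∀ {χ L a u u′} → E χ ⟦ L ⟧ a → u ∈ L → u′ ∈ L → ¬ SameColourBelow χ a u u′
E-separates Ea u∈L u′∈L (u<a , u′<a , u≢u′ , eq) =
  u≢u′ (proj₁ (Ea _ _ _ _ (inj₁ u∈L) (inj₂ refl) (inj₁ u′∈L) (inj₂ refl) u<a u′<a eq))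

record Conflict (χ : Coloring) (S : Subset) : Set where
  constructor conflict
  field
    {a₀ a₁ b₀ b₁} : ℕ
    a₀∈ : S a₀
    a₁∈ : S a₁
    b₀∈ : S b₀
    b₁∈ : S b₁
    a₀<a₁ : a₀ < a₁
    b₀<b₁ : b₀ < b₁
    same-colour : χ a₀ a₁ ≡ χ b₀ b₁
    different : ¬ (a₀ ≡ b₀ × a₁ ≡ b₁)

find-conflict : ExcludedMiddle 0ℓ → ∀ {χ S} → ¬ Polychromatic χ S → Conflict χ S
find-conflict em not-poly = dne λ no-conflict → not-poly
  λ a₀ a₁ b₀ b₁ a₀∈ a₁∈ b₀∈ b₁∈ a₀<a₁ b₀<b₁ eq →
    dne λ different → no-conflict (conflict a₀∈ a₁∈ b₀∈ b₁∈ a₀<a₁ b₀<b₁ eq different)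
  where
  dne : DoubleNegationElimination 0ℓ
  dne = em⇒dne em

data NewPointConflict (χ : Coloring) (S : List ℕ) (a : ℕ) : Set where
  at-top    : ∀ {u u′} → u ∈ S → u′ ∈ S → SameColourBelow χ a u u′ → NewPointConflict χ S a
  below-top : ∀ {q v}  → q ∈ S → v ∈ S → SameColourBelow χ v a q → NewPointConflict χ S a

module _ (em : ExcludedMiddle 0ℓ) {χ : Coloring} {A : Subset} (normal : Normal χ A) where

  -- Within a normal set, conflicting pairs share their top; since S is polychromatic, the new
  -- point a must occur in the conflict, which leaves exactly the two shapes above.
  new-point-conflict : ∀ {S a} → All A S → A a → Polychromatic χ ⟦ S ⟧ → ¬ E χ ⟦ S ⟧ a →
    NewPointConflict χ S a
  new-point-conflict {S} {a} AS Aa poly a∉E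
    with conflict a₀∈ a₁∈ b₀∈ b₁∈ a₀<a₁ b₀<b₁ eq different ← find-conflict em a∉E =
    classify a₀∈ a₁∈ b₀∈ a₀<a₁ b₀<b₁ eq different
      (normal _ _ _ _ (inA a₀∈) (inA a₁∈) (inA b₀∈) (inA b₁∈) a₀<a₁ b₀<b₁ eq)
    where
    inA : ∀ {u} → (⟦ S ⟧ ∪ (λ x → x ≡ a)) u → A u
    inA (inj₁ u∈S) = All.lookup AS u∈S
    inA (inj₂ refl) = Aa

    classify : ∀ {a₀ a₁ b₀ b₁} → (⟦ S ⟧ ∪ (λ x → x ≡ a)) a₀ → (⟦ S ⟧ ∪ (λ x → x ≡ a)) a₁ →
      (⟦ S ⟧ ∪ (λ x → x ≡ a)) b₀ → a₀ < a₁ → b₀ < b₁ → χ a₀ a₁ ≡ χ b₀ b₁ →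
      ¬ (a₀ ≡ b₀ × a₁ ≡ b₁) → a₁ ≡ b₁ → NewPointConflict χ S a
    classify (inj₁ a₀∈) (inj₁ a₁∈) (inj₁ b₀∈) a₀<a₁ b₀<b₁ eq diff refl =
      ⊥-elim (diff (poly _ _ _ _ a₀∈ a₁∈ b₀∈ a₁∈ a₀<a₁ b₀<b₁ eq))
    classify (inj₂ refl) (inj₁ a₁∈) (inj₁ b₀∈) a<a₁ b₀<a₁ eq diff refl =
      below-top b₀∈ a₁∈ (a<a₁ , b₀<a₁ , (λ a≡b₀ → diff (a≡b₀ , refl)) , eq)
    classify (inj₁ a₀∈) (inj₁ a₁∈) (inj₂ refl) a₀<a₁ a<a₁ eq diff refl =
      below-top a₀∈ a₁∈ (a<a₁ , a₀<a₁ , (λ a≡a₀ → diff (sym a≡a₀ , refl)) , sym eq)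
    classify (inj₂ refl) (inj₁ _) (inj₂ refl) _ _ _ diff refl = ⊥-elim (diff (refl , refl))
    classify (inj₁ a₀∈) (inj₂ refl) (inj₁ b₀∈) a₀<a b₀<a eq diff refl =
      at-top a₀∈ b₀∈ (a₀<a , b₀<a , (λ a₀≡b₀ → diff (a₀≡b₀ , refl)) , eq)
    classify (inj₂ refl) (inj₂ refl) _ a<a _ _ _ refl = ⊥-elim (<-irrefl refl a<a)
    classify (inj₁ _) (inj₂ refl) (inj₂ refl) _ a<a _ _ refl = ⊥-elim (<-irrefl refl a<a)

  partner : ∀ {L c a} → All A (c ∷ L) → A a → E χ ⟦ L ⟧ c → E χ ⟦ L ⟧ a →
    All (_< a) (c ∷ L) → ¬ E χ ⟦ c ∷ L ⟧ a → Σ ℕ λ x → x ∈ L × SameColourBelow χ a c x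
  partner Ac∷L Aa Ec Ea below a∉E with new-point-conflict Ac∷L Aa (E⇒polychromatic-∷ Ec) a∉E
  ... | below-top _ v∈ (a<v , _) = ⊥-elim (<-asym a<v (All.lookup below v∈))
  ... | at-top (here refl) (here refl) (_ , _ , c≢c , _) = ⊥-elim (c≢c refl)
  ... | at-top (here refl) (there x∈L) same = _ , x∈L , same
  ... | at-top (there x∈L) (here refl) same = _ , x∈L , same-colour-sym {χ} same
  ... | at-top (there u∈L) (there u′∈L) same = ⊥-elim (E-separates Ea u∈L u′∈L same)

  spoiler : ∀ {L y z} → All A (y ∷ L) → A z → E χ ⟦ L ⟧ y → E χ ⟦ L ⟧ z → z < y →
    ¬ E χ ⟦ y ∷ L ⟧ z →
    Σ (ℕ × ℕ) λ (q , v) → (q , v) ∈ cartesianProduct (y ∷ L) (y ∷ L) × SameColourBelow χ v z q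
  spoiler Ay∷L Az Ey Ez z<y z∉E with new-point-conflict Ay∷L Az (E⇒polychromatic-∷ Ey) z∉E
  ... | below-top q∈ v∈ same = _ , ∈-cartesianProduct⁺ q∈ v∈ , same
  ... | at-top (here refl) _ (y<z , _) = ⊥-elim (<-asym y<z z<y)
  ... | at-top _ (here refl) (_ , y<z , _) = ⊥-elim (<-asym y<z z<y)
  ... | at-top (there u∈L) (there u′∈L) same = ⊥-elim (E-separates Ez u∈L u′∈L same)

module _ {I : Subset → Set} (ideal : IsIdealWithFinite I) where
  open IsIdealWithFinite ideal

  positive⇒inhabited : ExcludedMiddle 0ℓ → ∀ {S} → ¬ I S → Σ ℕ S
  positive⇒inhabited em positive = em⇒dne em λ empty →
    positive (downward _ ⟦ [] ⟧ (λ x x∈S → ⊥-elim (empty (x , x∈S))) (finite []))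

  ⋃-small : (F : ℕ → Subset) (cs : List ℕ) → All (λ c → I (F c)) cs →
    I (λ a → Any (λ c → F c a) cs)
  ⋃-small F []       []            = downward _ ⟦ [] ⟧ (λ _ ()) (finite [])
  ⋃-small F (c ∷ cs) (small ∷ all) = downward _ (F c ∪ (λ a → Any (λ c → F c a) cs))
    (λ where _ (here a∈) → inj₁ a∈
             _ (there a∈) → inj₂ a∈)
    (union _ _ small (⋃-small F cs all))

  positive-antitone : ∀ {χ A S T} → S ⊆ T → ¬ I (A ∩ E χ T) → ¬ I (A ∩ E χ S)
  positive-antitone S⊆T positive small =
    positive (downward _ _ (λ a (Aa , Ea) → Aa , E-antitone S⊆T a Ea) small)

h : ℕ → ℕ → ℕ
h p zero    = 0
h p (suc n) = suc p + (suc p * suc p + h (suc p) n)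

module Construction (em : ExcludedMiddle 0ℓ) {χ : Coloring} {A : Subset} {I : Subset → Set}
  (two-bounded : TwoBounded χ) (normal : Normal χ A) (ideal : IsIdealWithFinite I) where

  open IsIdealWithFinite ideal

  E? : (S : Subset) → Decidable (E χ S)
  E? S z = em

  -- A point a above cs and L lying in A ∩ E(L) but in no E(c ∷ L), c ∈ cs, gives every c a
  -- partner in L; different c get different partners, so |cs| ≤ |L|.
  unextendable-point : ∀ {L cs a} → Unique cs → All (A ∩ E χ ⟦ L ⟧) cs → All A L → A a →
    E χ ⟦ L ⟧ a → All (_< a) cs → All (_< a) L → All (λ c → ¬ E χ ⟦ c ∷ L ⟧ a) cs →
    length cs ≤ length L
  unextendable-point unique cands AL Aa Ea cs<a L<a not-extended =
    pigeonhole (SameColourBelow χ _) unique partner-of (same-colour-unique two-bounded)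
    where
    partner-of : ∀ {c} → _ → Σ ℕ λ x → x ∈ _ × SameColourBelow χ _ c x
    partner-of c∈cs with Ac , Ec ← All.lookup cands c∈cs =
      partner em normal (Ac ∷ AL) Aa Ec Ea (All.lookup cs<a c∈cs ∷ L<a) (All.lookup not-extended c∈cs)

  -- Otherwise A ∩ E(L) would be covered by an initial
  -- segment and the small sets A ∩ E(c ∷ L), since large uncovered points are ruled out above.
  extension : ∀ {L cs p} → All A L → length L ≤ p → ¬ I (A ∩ E χ ⟦ L ⟧) → Unique cs →
    suc p ≤ length cs → All (A ∩ E χ ⟦ L ⟧) cs → Σ ℕ λ y → y ∈ cs × ¬ I (A ∩ E χ ⟦ y ∷ L ⟧)
  extension {L} {cs} {p} AL |L|≤p positive unique p<|cs| cands
    with em {Any (λ c → ¬ I (A ∩ E χ ⟦ c ∷ L ⟧)) cs}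
  ... | yes some = find some
  ... | no none  = ⊥-elim (positive (downward _ _ covered
        (union _ _ (finite (upTo (suc N))) (⋃-small ideal Extended cs small))))
    where
    N : ℕ
    N = max 0 (cs ++ L)
    Extended : ℕ → Subset
    Extended c = A ∩ E χ ⟦ c ∷ L ⟧
    small : All (λ c → I (Extended c)) cs
    small = All.tabulate λ c∈cs → em⇒dne em λ not-small → none (lose c∈cs not-small)
    covered : (A ∩ E χ ⟦ L ⟧) ⊆ (⟦ upTo (suc N) ⟧ ∪ (λ a → Any (λ c → Extended c a) cs))
    covered a (Aa , Ea) with a ≤? N
    ... | yes a≤N = inj₁ (∈-upTo⁺ (s≤s a≤N))
    ... | no  a≰N = inj₂ (em⇒dne em λ uncovered → n≮n p (≤-trans p<|cs| (≤-trans
          (unextendable-point unique cands AL Aa Ea cs<a L<a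
            (All.tabulate λ c∈cs Ea′ → uncovered (lose c∈cs (Aa , Ea′))))
          |L|≤p)))
      where
      below : All (_< a) (cs ++ L)
      below = All.map (λ x≤N → ≤-<-trans x≤N (≰⇒> a≰N)) (xs≤max 0 (cs ++ L))
      cs<a : All (_< a) cs
      cs<a = proj₁ (All.++⁻ cs below)
      L<a : All (_< a) L
      L<a = proj₂ (All.++⁻ cs below)

  spoiled : List ℕ → ℕ → List ℕ → List ℕ
  spoiled L y zs = filter (λ z → ¬? (E? ⟦ y ∷ L ⟧ z)) zs

  -- Few-spoiled lemma: each spoiled candidate determines a pair of y ∷ L, injectively.
  few-spoiled : ∀ {L y} → All A L → A y → E χ ⟦ L ⟧ y → (zs : List ℕ) → Unique zs →
    All (_< y) zs → All (A ∩ E χ ⟦ L ⟧) zs →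
    length (spoiled L y zs) ≤ suc (length L) * suc (length L)
  few-spoiled {L} {y} AL Ay Ey zs unique zs<y cands = begin
    length (spoiled L y zs)                    ≤⟨ pigeonhole (λ z (q , v) → SameColourBelow χ v z q)
                                                    (Unique.filter⁺ _ unique) witness
                                                    (same-colour-unique two-bounded) ⟩
    length (cartesianProduct (y ∷ L) (y ∷ L))  ≡⟨ length-cartesianProduct (y ∷ L) (y ∷ L) ⟩
    suc (length L) * suc (length L)            ∎
    where
    open ≤-Reasoning
    witness : ∀ {z} → z ∈ spoiled L y zs →
      Σ (ℕ × ℕ) λ (q , v) → (q , v) ∈ cartesianProduct (y ∷ L) (y ∷ L) × SameColourBelow χ v z q
    witness z∈ with z∈zs , z∉E ← ∈-filter⁻ (λ z → ¬? (E? ⟦ y ∷ L ⟧ z)) {xs = zs} z∈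
               with Az , Ez ← All.lookup cands z∈zs =
      spoiler em normal (Ay ∷ AL) Az Ey Ez (All.lookup zs<y z∈zs) z∉E

  record Round (p n : ℕ) (L Zs : List ℕ) : Set where
    field
      y          : ℕ
      y∈Zs       : y ∈ Zs
      positive   : ¬ I (A ∩ E χ ⟦ y ∷ L ⟧)
      rest       : List ℕ
      rest⊆Zs    : All (_∈ Zs) rest
      rest<y     : All (_< y) rest
      decreasing : AllPairs _>_ rest
      candidates : All (A ∩ E χ ⟦ y ∷ L ⟧) rest
      large      : h (suc p) n ≤ length rest

  -- y is taken from the first p+1 candidates; the later ones that are not spoiled are kept.
  round : ∀ {p n L} → All A L → length L ≤ p → ¬ I (A ∩ E χ ⟦ L ⟧) → (Zs : List ℕ) →
    AllPairs _>_ Zs → All (A ∩ E χ ⟦ L ⟧) Zs → h p (suc n) ≤ length Zs → Round p n L Zs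
  round {p} {n} {L} AL |L|≤p positive Zs decreasing cands big
    with cs , later , refl , |cs|≡ ← prefix-of-length (suc p) Zs (≤-trans (m≤m+n (suc p) _) big)
    with cs-dec , later-dec , cs>later ← AllPairs-++⁻ cs decreasing
    with cs-cands , later-cands ← All.++⁻ cs cands
    with y , y∈cs , positive′ ← extension AL |L|≤p positive (AllPairs.map >⇒≢ cs-dec)
                                  (≤-reflexive (sym |cs|≡)) cs-cands
    = record
      { y = y ; y∈Zs = ∈-++⁺ˡ y∈cs ; positive = positive′ ; rest = kept
      ; rest⊆Zs = All.tabulate λ z∈ → ∈-++⁺ʳ cs (proj₁ (∈-filter⁻ keep? {xs = later} z∈))
      ; rest<y = All.filter⁺ keep? later<y
      ; decreasing = AllPairsₚ.filter⁺ keep? later-dec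
      ; candidates = All.tabulate λ z∈ → let z∈later , Ez = ∈-filter⁻ keep? {xs = later} z∈
                                        in proj₁ (All.lookup later-cands z∈later) , Ez
      ; large = enough
      }
    where
    open ≤-Reasoning
    keep? : Decidable (E χ ⟦ y ∷ L ⟧)
    keep? = E? ⟦ y ∷ L ⟧
    kept : List ℕ
    kept = filter keep? later
    later<y : All (_< y) later
    later<y = All.lookup cs>later y∈cs
    Ay : A y
    Ay = proj₁ (All.lookup cs-cands y∈cs)
    few : length (spoiled L y later) ≤ suc p * suc p
    few = ≤-trans (few-spoiled AL Ay (proj₂ (All.lookup cs-cands y∈cs)) later
                    (AllPairs.map >⇒≢ later-dec) later<y later-cands)
                  (*-mono-≤ (s≤s |L|≤p) (s≤s |L|≤p))
    enough : h (suc p) n ≤ length kept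
    enough = +-cancelˡ-≤ (suc p * suc p) _ _ (begin
      suc p * suc p + h (suc p) n     ≤⟨ +-cancelˡ-≤ (suc p) _ _ (begin
        suc p + (suc p * suc p + h (suc p) n) ≤⟨ big ⟩
        length (cs ++ later)                 ≡⟨ length-++ cs ⟩
        length cs + length later             ≡⟨ cong (_+ length later) |cs|≡ ⟩
        suc p + length later                 ∎) ⟩
      length later                    ≡⟨ length-filter-split keep? later ⟨
      length kept + length (spoiled L y later) ≤⟨ +-monoʳ-≤ (length kept) few ⟩
      length kept + suc p * suc p     ≡⟨ +-comm (length kept) _ ⟩
      suc p * suc p + length kept     ∎)

  construct : ∀ n p L Zs → All A L → length L ≤ p → ¬ I (A ∩ E χ ⟦ L ⟧) →
    AllPairs _>_ Zs → All (A ∩ E χ ⟦ L ⟧) Zs → h p n ≤ length Zs →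
    Σ (List ℕ) λ Y → AllPairs _>_ Y × All (_∈ Zs) Y × n ≤ length Y ×
      ¬ I (A ∩ E χ (⟦ L ⟧ ∪ ⟦ Y ⟧))
  construct zero p L Zs AL |L|≤p positive decreasing cands big =
    [] , [] , [] , z≤n , positive-antitone ideal (λ where _ (inj₁ x∈L) → x∈L) positive
  construct (suc n) p L Zs AL |L|≤p positive decreasing cands big
    with r ← round {n = n} AL |L|≤p positive Zs decreasing cands big
    with Y , Y-dec , Y⊆rest , n≤|Y| , positiveY ←
           construct n (suc p) (Round.y r ∷ L) (Round.rest r)
             (proj₁ (All.lookup cands (Round.y∈Zs r)) ∷ AL) (s≤s |L|≤p) (Round.positive r)
             (Round.decreasing r) (Round.candidates r) (Round.large r)
    = Round.y r ∷ Y
    , All.map (All.lookup (Round.rest<y r)) Y⊆rest ∷ Y-dec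
    , Round.y∈Zs r ∷ All.map (All.lookup (Round.rest⊆Zs r)) Y⊆rest
    , s≤s n≤|Y|
    , positive-antitone ideal regroup positiveY
    where
    regroup : (⟦ L ⟧ ∪ ⟦ Round.y r ∷ Y ⟧) ⊆ (⟦ Round.y r ∷ L ⟧ ∪ ⟦ Y ⟧)
    regroup _ (inj₁ x∈L)         = inj₁ (there x∈L)
    regroup _ (inj₂ (here x≡y))  = inj₁ (here x≡y)
    regroup _ (inj₂ (there x∈Y)) = inj₂ x∈Y

mainTheorem19 : ExcludedMiddle 0ℓ →
    Σ (ℕ → ℕ → ℕ) λ h →
    ∀ (χ : Coloring) (A : Subset) (I : Subset → Set) (p n : ℕ)
    (X : List ℕ) (Z : Subset) →
    TwoBounded χ → Normal χ A → IsIdealWithFinite I →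
    Unique X → All A X → Polychromatic χ ⟦ X ⟧ → length X ≤ p →
    ¬ I (A ∩ E χ ⟦ X ⟧) →
    Z ⊆ (A ∩ E χ ⟦ X ⟧) →
    (Zs : List ℕ) → Unique Zs → All Z Zs → h p n ≤ length Zs →
    Σ (List ℕ) λ Y →
    Unique Y × All Z Y × n ≤ length Y ×
    Polychromatic χ (⟦ X ⟧ ∪ ⟦ Y ⟧) ×
    ¬ I (A ∩ E χ (⟦ X ⟧ ∪ ⟦ Y ⟧))
mainTheorem19 em = h , λ χ A I p n X Z two-bounded normal ideal _ AX _ |X|≤p positive Z⊆AE
                         Zs unique inZ big →
  let Zs↓ , decreasing , Zs↓↭Zs = sort-decreasing Zs unique
      inZ↓ = All-resp-↭ (↭-sym Zs↓↭Zs) inZ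
      Y , Y-dec , Y⊆Zs↓ , n≤|Y| , positiveY =
        Construction.construct em two-bounded normal ideal n p X Zs↓ AX |X|≤p positive decreasing
          (All.map (Z⊆AE _) inZ↓) (subst (h p n ≤_) (sym (↭-length Zs↓↭Zs)) big)
      a , _ , a∈E = positive⇒inhabited ideal em positiveY
  in Y , AllPairs.map >⇒≢ Y-dec , All.map (All.lookup inZ↓) Y⊆Zs↓ , n≤|Y| ,
     E⇒polychromatic a∈E , positiveY
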